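{- Let $\mathcal{C}$ be the set of all finite compositions $\mu = (\mu_1, \ldots, \mu_k)$ (including the empty composition $()$) with each $\mu_i \in \{1, 2\}$ and such that the last part is not $2$; write $|\mu| = \mu_1 + \cdots + \mu_k$. Define maps $\mu \mapsto \lambda_d(\mu)$ and $\mu \mapsto \lambda_o(\mu)$ from $\mathcal{C}$ to partitions recursively as follows. If $\mu = ()$, then $\lambda_d(\mu) = \lambda_o(\mu)$ is the empty partition; if $\mu = (1)$, then $\lambda_d(\mu) = \lambda_o(\mu) = (1)$. Otherwise write $\mu = (\mu_1, \mu')$ with $\mu_1 \in \{1,2\}$ and $\mu' \in \mathcal{C}$ nonempty. - For $\lambda_d$: let $\lambda_d(\mu') = (\lambda_1, \lambda_2, \lambda_3, \ldots)$. If $\mu_1 = 1$, set $\lambda_d(\mu) = (\lambda_1 + 1, \lambda_2, \lambda_3, \ldots)$; if $\mu_1 = 2$, set $\lambda_d(\mu) = (\lambda_1 + 1, \lambda_1, \lambda_2, \lambda_3, \ldots)$. - For $\lambda_o$: let $\lambda_o(\mu') = (\lambda_1, \lambda_2, \lambda_3, \ldots)$. If $\mu_1 = 1$, set $\lambda_o(\mu) = (\lambda_1, \lambda_1, \lambda_2, \lambda_3, \ldots)$; if $\mu_1 = 2$, set $\lambda_o(\mu) = (\lambda_1 + 2, \lambda_2, \lambda_3, \ldots)$. Then $\mu \mapsto \lambda_d(\mu)$ is a bijection from $\mathcal{C}$ onto the set of partitions into distinct parts, $\mu \mapsto \lambda_o(\mu)$ is a bijection from $\mathcal{C}$ onto the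 set of partitions into odd parts, and for every $\mu \in \mathcal{C}$ both $\lambda_d(\mu)$ and $\lambda_o(\mu)$ have perimeter $|\mu|$.
   Context: A partition $\lambda = (\lambda_1, \ldots, \lambda_\ell)$ is a finite weakly decreasing sequence of positive integers (the empty partition is allowed). It is a partition into distinct parts if $\lambda_1 > \cdots > \lambda_\ell$, and into odd parts if every $\lambda_i$ is odd. The perimeter of a nonempty partition is $\lambda_1 + \ell - 1$; the empty partition has perimeter $0$. -}

module Defs where

open import Data.Nat using (ℕ; zero; suc; _+_; _>_; _≥_)
open import Data.List using (List; []; _∷_; sum; length)
open import Data.List.Relation.Unary.All using (All)
open import Data.List.Relation.Unary.Linked using (Linked)
open import Data.Product using (Σ; _×_; _,_)
open import Relation.Binary.PropositionalEquality using (_≡_; _≢_)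
open import Data.Nat.Properties using ()

data Part : Set where
  one two : Part

val : Part → ℕ
val one = 1
val two = 2

size : List Part → ℕ
size []      = 0
size (p ∷ μ) = val p + size μ

data LastNotTwo : List Part → Set where
  empty  : LastNotTwo []
  single : LastNotTwo (one ∷ [])
  cons   : ∀ {p q μ} → LastNotTwo (q ∷ μ) → LastNotTwo (p ∷ q ∷ μ)

InC : List Part → Set
InC μ = LastNotTwo μ

IsPartition : List ℕ → Set
IsPartition λs = All (λ x → x > 0) λs × Linked _≥_ λs

IsDistinctPartition : List ℕ → Set
IsDistinctPartition λs = All (λ x → x > 0) λs × Linked _>_ λs

data Odd : ℕ → Set where
  odd1 : Odd 1
  odd+2 : ∀ {n} → Odd n → Odd (suc (suc n))

IsOddPartition : List ℕ → Set
IsOddPartition λs = IsPartition λs × All Odd λs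

-- Perimeter: λ₁ + ℓ - 1 for nonempty, 0 for empty.
perimeter : List ℕ → ℕ
perimeter []       = 0
perimeter (x ∷ xs) = x + length xs

-- λ_d and λ_o (on arbitrary lists of parts; the recursion matches the paper on 𝒞,
-- and the value for a list ending in 2 is irrelevant).
λd : List Part → List ℕ
λd []           = []
λd (one ∷ [])   = 1 ∷ []
λd (two ∷ [])   = []
λd (p ∷ q ∷ μ) with λd (q ∷ μ)
... | []       = []    -- does not occur on 𝒞
... | l₁ ∷ ls with p
...   | one = suc l₁ ∷ ls
...   | two = suc l₁ ∷ l₁ ∷ ls

λo : List Part → List ℕ
λo []           = []
λo (one ∷ [])   = 1 ∷ []
λo (two ∷ [])   = []
λo (p ∷ q ∷ μ) with λo (q ∷ μ)
... | []       = []    -- does not occur on 𝒞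
... | l₁ ∷ ls with p
...   | one = l₁ ∷ l₁ ∷ ls
...   | two = suc (suc l₁) ∷ ls

BijectionFromCOnto : (List Part → List ℕ) → (List ℕ → Set) → Set
BijectionFromCOnto f P =
    (∀ μ → InC μ → P (f μ))
  × (∀ μ ν → InC μ → InC ν → f μ ≡ f ν → μ ≡ ν)
  × (∀ l → P l → Σ (List Part) (λ μ → InC μ × f μ ≡ l))

module Submission where

-- Both maps unfold one step: for a nonempty composition, λ(p ∷ μ′) is obtained
-- from the nonempty partition λ(μ′) by a step depending on p, and this step raises
-- the perimeter by p.  For distinct (resp. odd) partitions the step is a bijection
-- from {1,2} × (nonempty partitions of the class) onto the nonempty partitions of
-- the class other than (1): the largest part of a distinct partition exceeds the
-- second one either by exactly 1 (undo step 2) or by more (undo step 1), and the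
-- largest part of an odd partition either equals the second one (undo step 1) or
-- exceeds it by at least 2 (undo step 2).  Induction on the perimeter then turns
-- the step bijection into the bijections of the theorem.

open import Defs
open import Data.Nat using (ℕ; zero; suc; _+_; _≤_; _<_; _>_; _≥_; z≤n; s≤s)
open import Data.Nat.Properties
  using (+-suc; +-mono-≤; m≤m+n; m<n+m; ≤-pred; ≤-refl; ≤-trans; m≤n⇒m≤1+n; <-irrefl; <⇒≤; <⇒≱; ≤⇒≯; m≤n⇒m<n∨m≡n)
open import Data.Nat.Induction using (<-wellFounded)
open import Induction.WellFounded using (Acc; acc)
open import Data.List using (List; []; _∷_; length)
open import Data.List.NonEmpty using (List⁺; _∷_; [_]; toList)
open import Data.List.Relation.Unary.All using ([]; _∷_)
open import Data.List.Relation.Unary.Linked using (Linked; []; [-]; _∷_)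
open import Data.Product using (Σ; ∃₂; _×_; _,_)
open import Data.Sum using (_⊎_; inj₁; inj₂)
open import Data.Empty using (⊥-elim)
open import Relation.Nullary using (¬_; contradiction)
open import Relation.Binary.PropositionalEquality
  using (_≡_; _≢_; refl; sym; trans; cong; subst; module ≡-Reasoning)

val-positive : ∀ p → 0 < val p
val-positive one = s≤s z≤n
val-positive two = s≤s z≤n

2≤size : ∀ p q μ → 2 ≤ size (p ∷ q ∷ μ)
2≤size p q μ = +-mono-≤ (val-positive p) (≤-trans (val-positive q) (m≤m+n (val q) (size μ)))

short≢long : ∀ {n} p q ν → n ≤ 1 → n ≢ size (p ∷ q ∷ ν)
short≢long p q ν n≤1 e = ≤⇒≯ n≤1 (subst (1 <_) (sym e) (2≤size p q ν))

toList-injective : ∀ {A : Set} {xs ys : List⁺ A} → toList xs ≡ toList ys → xs ≡ ys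
toList-injective {xs = _ ∷ _} {ys = _ ∷ _} refl = refl

record StepDecomposition (f : List Part → List ℕ) (P : List ℕ → Set) : Set where
  field
    step            : Part → List⁺ ℕ → List⁺ ℕ
    f-[]            : f [] ≡ []
    f-[1]           : f (one ∷ []) ≡ 1 ∷ []
    f-step          : ∀ p q μ {xs} → f (q ∷ μ) ≡ toList xs → f (p ∷ q ∷ μ) ≡ toList (step p xs)
    P-[]            : P []
    P-[1]           : P (1 ∷ [])
    step-preserves  : ∀ p {xs} → P (toList xs) → P (toList (step p xs))
    step-perimeter  : ∀ p xs → perimeter (toList (step p xs)) ≡ val p + perimeter (toList xs)
    step-injective  : ∀ {p p′ xs ys} → P (toList xs) → P (toList ys) →
                      step p xs ≡ step p′ ys → p ≡ p′ × xs ≡ ys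
    step-surjective : ∀ xs → P (toList xs) →
                      xs ≡ [ 1 ] ⊎ ∃₂ λ p ys → P (toList ys) × xs ≡ step p ys

module _ {f : List Part → List ℕ} {P : List ℕ → Set} (S : StepDecomposition f P) where
  open StepDecomposition S

  f-nonempty : ∀ q μ → InC (q ∷ μ) → Σ (List⁺ ℕ) λ xs → f (q ∷ μ) ≡ toList xs
  f-nonempty one [] single   = [ 1 ] , f-[1]
  f-nonempty p (q ∷ μ) (cons c) with f-nonempty q μ c
  ... | xs , e = step p xs , f-step p q μ e

  f-preserves : ∀ μ → InC μ → P (f μ)
  f-preserves [] empty = subst P (sym f-[]) P-[]
  f-preserves (one ∷ []) single = subst P (sym f-[1]) P-[1]
  f-preserves (p ∷ q ∷ μ) (cons c) with f-nonempty q μ c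
  ... | xs , e = subst P (sym (f-step p q μ e)) (step-preserves p (subst P e (f-preserves (q ∷ μ) c)))

  perimeter-f : ∀ μ → InC μ → perimeter (f μ) ≡ size μ
  perimeter-f [] empty = cong perimeter f-[]
  perimeter-f (one ∷ []) single = cong perimeter f-[1]
  perimeter-f (p ∷ q ∷ μ) (cons c) with f-nonempty q μ c
  ... | xs , e = begin
    perimeter (f (p ∷ q ∷ μ))        ≡⟨ cong perimeter (f-step p q μ e) ⟩
    perimeter (toList (step p xs))   ≡⟨ step-perimeter p xs ⟩
    val p + perimeter (toList xs)    ≡⟨ cong (λ ys → val p + perimeter ys) e ⟨
    val p + perimeter (f (q ∷ μ))    ≡⟨ cong (val p +_) (perimeter-f (q ∷ μ) c) ⟩
    val p + size (q ∷ μ)             ∎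
    where open ≡-Reasoning

  same-size : ∀ μ ν → InC μ → InC ν → f μ ≡ f ν → size μ ≡ size ν
  same-size μ ν c c′ e = trans (sym (perimeter-f μ c)) (trans (cong perimeter e) (perimeter-f ν c′))

  f-injective : ∀ μ ν → InC μ → InC ν → f μ ≡ f ν → μ ≡ ν
  f-injective [] [] empty empty _ = refl
  f-injective (one ∷ []) (one ∷ []) single single _ = refl
  f-injective [] (one ∷ []) empty single e = contradiction (same-size [] (one ∷ []) empty single e) λ ()
  f-injective (one ∷ []) [] single empty e = contradiction (same-size (one ∷ []) [] single empty e) λ ()
  f-injective [] (p ∷ q ∷ ν) empty (cons c) e =
    ⊥-elim (short≢long p q ν z≤n (same-size [] (p ∷ q ∷ ν) empty (cons c) e))
  f-injective (one ∷ []) (p ∷ q ∷ ν) single (cons c) e =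
    ⊥-elim (short≢long p q ν ≤-refl (same-size (one ∷ []) (p ∷ q ∷ ν) single (cons c) e))
  f-injective (p ∷ q ∷ μ) [] (cons c) empty e =
    ⊥-elim (short≢long p q μ z≤n (same-size [] (p ∷ q ∷ μ) empty (cons c) (sym e)))
  f-injective (p ∷ q ∷ μ) (one ∷ []) (cons c) single e =
    ⊥-elim (short≢long p q μ ≤-refl (same-size (one ∷ []) (p ∷ q ∷ μ) single (cons c) (sym e)))
  f-injective (p ∷ q ∷ μ) (p′ ∷ q′ ∷ ν) (cons c) (cons c′) e
    with f-nonempty q μ c | f-nonempty q′ ν c′
  ... | xs , ex | ys , ey
    with step-injective (subst P ex (f-preserves (q ∷ μ) c)) (subst P ey (f-preserves (q′ ∷ ν) c′))
           (toList-injective (trans (sym (f-step p q μ ex)) (trans e (f-step p′ q′ ν ey))))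
  ... | refl , refl = cong (p ∷_) (f-injective (q ∷ μ) (q′ ∷ ν) c c′ (trans ex (sym ey)))

  perimeter-step : ∀ p xs → perimeter (toList xs) < perimeter (toList (step p xs))
  perimeter-step p xs =
    subst (perimeter (toList xs) <_) (sym (step-perimeter p xs)) (m<n+m _ (val-positive p))

  preimage⁺ : ∀ xs → P (toList xs) → Acc _<_ (perimeter (toList xs)) →
              Σ Part λ q → Σ (List Part) λ μ → InC (q ∷ μ) × f (q ∷ μ) ≡ toList xs
  preimage⁺ xs Pxs (acc rec) with step-surjective xs Pxs
  ... | inj₁ refl = one , [] , single , f-[1]
  ... | inj₂ (p , ys , Pys , refl) with preimage⁺ ys Pys (rec (perimeter-step p ys))
  ...   | q , μ , c , e = p , q ∷ μ , cons c , f-step p q μ e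

  f-surjective : ∀ xs → P xs → Σ (List Part) λ μ → InC μ × f μ ≡ xs
  f-surjective [] _ = [] , empty , f-[]
  f-surjective (x ∷ xs) Pxs with preimage⁺ (x ∷ xs) Pxs (<-wellFounded _)
  ... | q , μ , c , e = q ∷ μ , c , e

  bijection : BijectionFromCOnto f P
  bijection = f-preserves , f-injective , f-surjective

stepD : Part → List⁺ ℕ → List⁺ ℕ
stepD one (l ∷ ls) = suc l ∷ ls
stepD two (l ∷ ls) = suc l ∷ l ∷ ls

λd-step : ∀ p q μ {xs} → λd (q ∷ μ) ≡ toList xs → λd (p ∷ q ∷ μ) ≡ toList (stepD p xs)
λd-step one q μ {_ ∷ _} e rewrite e = refl
λd-step two q μ {_ ∷ _} e rewrite e = refl

suc-head-> : ∀ {l ls} → Linked _>_ (l ∷ ls) → Linked _>_ (suc l ∷ ls)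
suc-head-> [-]         = [-]
suc-head-> (l>l′ ∷ ls) = m≤n⇒m≤1+n l>l′ ∷ ls

stepD-preserves : ∀ p {xs} → IsDistinctPartition (toList xs) → IsDistinctPartition (toList (stepD p xs))
stepD-preserves one {_ ∷ _} (_ ∷ pos , dec)   = s≤s z≤n ∷ pos , suc-head-> dec
stepD-preserves two {_ ∷ _} (l>0 ∷ pos , dec) = s≤s z≤n ∷ l>0 ∷ pos , ≤-refl ∷ dec

stepD-perimeter : ∀ p xs → perimeter (toList (stepD p xs)) ≡ val p + perimeter (toList xs)
stepD-perimeter one (l ∷ ls) = refl
stepD-perimeter two (l ∷ ls) = cong suc (+-suc l (length ls))

stepD-injective : ∀ {p p′ xs ys} → IsDistinctPartition (toList xs) → IsDistinctPartition (toList ys) →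
                  stepD p xs ≡ stepD p′ ys → p ≡ p′ × xs ≡ ys
stepD-injective {one} {one} {_ ∷ _} {_ ∷ _} _ _ refl = refl , refl
stepD-injective {two} {two} {_ ∷ _} {_ ∷ _} _ _ refl = refl , refl
stepD-injective {one} {two} {_ ∷ _} {_ ∷ _} (_ , l>l ∷ _) _ refl = contradiction l>l (<-irrefl refl)
stepD-injective {two} {one} {_ ∷ _} {_ ∷ _} _ (_ , l>l ∷ _) refl = contradiction l>l (<-irrefl refl)

stepD-surjective : ∀ xs → IsDistinctPartition (toList xs) →
                   xs ≡ [ 1 ] ⊎ ∃₂ λ p ys → IsDistinctPartition (toList ys) × xs ≡ stepD p ys
stepD-surjective (zero ∷ _) (() ∷ _ , _)
stepD-surjective (1 ∷ []) _ = inj₁ refl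
stepD-surjective (suc (suc l) ∷ []) _ = inj₂ (one , suc l ∷ [] , (s≤s z≤n ∷ [] , [-]) , refl)
stepD-surjective (suc l ∷ l′ ∷ ls) (_ ∷ l′>0 ∷ pos , suc-l>l′ ∷ dec) with m≤n⇒m<n∨m≡n (≤-pred suc-l>l′)
... | inj₂ refl = inj₂ (two , l ∷ ls , (l′>0 ∷ pos , dec) , refl)
... | inj₁ l>l′ = inj₂ (one , l ∷ l′ ∷ ls , (≤-trans l′>0 (<⇒≤ l>l′) ∷ l′>0 ∷ pos , l>l′ ∷ dec) , refl)

λd-decomposition : StepDecomposition λd IsDistinctPartition
λd-decomposition = record
  { step            = stepD
  ; f-[]            = refl
  ; f-[1]           = refl
  ; f-step          = λd-step
  ; P-[]            = [] , []
  ; P-[1]           = s≤s z≤n ∷ [] , [-]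
  ; step-preserves  = stepD-preserves
  ; step-perimeter  = stepD-perimeter
  ; step-injective  = stepD-injective
  ; step-surjective = stepD-surjective
  }

stepO : Part → List⁺ ℕ → List⁺ ℕ
stepO one (l ∷ ls) = l ∷ l ∷ ls
stepO two (l ∷ ls) = suc (suc l) ∷ ls

λo-step : ∀ p q μ {xs} → λo (q ∷ μ) ≡ toList xs → λo (p ∷ q ∷ μ) ≡ toList (stepO p xs)
λo-step one q μ {_ ∷ _} e rewrite e = refl
λo-step two q μ {_ ∷ _} e rewrite e = refl

odd⇒positive : ∀ {n} → Odd n → 0 < n
odd⇒positive odd1      = s≤s z≤n
odd⇒positive (odd+2 _) = s≤s z≤n

odd⇒¬odd-suc : ∀ {n} → Odd n → ¬ Odd (suc n)
odd⇒¬odd-suc odd1      (odd+2 ())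
odd⇒¬odd-suc (odd+2 o) (odd+2 o′) = odd⇒¬odd-suc o o′

odd-≤-pred : ∀ {m n} → Odd m → Odd n → m ≤ suc n → m ≤ n
odd-≤-pred om on m≤1+n with m≤n⇒m<n∨m≡n m≤1+n
... | inj₁ m<1+n = ≤-pred m<1+n
... | inj₂ refl  = contradiction om (odd⇒¬odd-suc on)

+2-head-≥ : ∀ {l ls} → Linked _≥_ (l ∷ ls) → Linked _≥_ (suc (suc l) ∷ ls)
+2-head-≥ [-]         = [-]
+2-head-≥ (l≥l′ ∷ ls) = m≤n⇒m≤1+n (m≤n⇒m≤1+n l≥l′) ∷ ls

stepO-preserves : ∀ p {xs} → IsOddPartition (toList xs) → IsOddPartition (toList (stepO p xs))
stepO-preserves one {_ ∷ _} ((l>0 ∷ pos , dec) , ol ∷ odd) = (l>0 ∷ l>0 ∷ pos , ≤-refl ∷ dec) , ol ∷ ol ∷ odd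
stepO-preserves two {_ ∷ _} ((_ ∷ pos , dec) , ol ∷ odd)   = (s≤s z≤n ∷ pos , +2-head-≥ dec) , odd+2 ol ∷ odd

stepO-perimeter : ∀ p xs → perimeter (toList (stepO p xs)) ≡ val p + perimeter (toList xs)
stepO-perimeter one (l ∷ ls) = +-suc l (length ls)
stepO-perimeter two (l ∷ ls) = refl

stepO-injective : ∀ {p p′ xs ys} → IsOddPartition (toList xs) → IsOddPartition (toList ys) →
                  stepO p xs ≡ stepO p′ ys → p ≡ p′ × xs ≡ ys
stepO-injective {one} {one} {_ ∷ _} {_ ∷ _} _ _ refl = refl , refl
stepO-injective {two} {two} {_ ∷ _} {_ ∷ _} _ _ refl = refl , refl
stepO-injective {one} {two} {_ ∷ _} {_ ∷ _} _ ((_ , l≥l+2 ∷ _) , _) refl =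
  contradiction l≥l+2 (<⇒≱ (m≤n⇒m≤1+n ≤-refl))
stepO-injective {two} {one} {_ ∷ _} {_ ∷ _} ((_ , l≥l+2 ∷ _) , _) _ refl =
  contradiction l≥l+2 (<⇒≱ (m≤n⇒m≤1+n ≤-refl))

stepO-surjective : ∀ xs → IsOddPartition (toList xs) →
                   xs ≡ [ 1 ] ⊎ ∃₂ λ p ys → IsOddPartition (toList ys) × xs ≡ stepO p ys
stepO-surjective (_ ∷ []) (_ , odd1 ∷ []) = inj₁ refl
stepO-surjective (_ ∷ []) (_ , odd+2 ol ∷ []) =
  inj₂ (two , _ ∷ [] , ((odd⇒positive ol ∷ [] , [-]) , ol ∷ []) , refl)
stepO-surjective (l ∷ l′ ∷ ls) ((_ ∷ l′>0 ∷ pos , l≥l′ ∷ dec) , ol ∷ ol′ ∷ odd) with m≤n⇒m<n∨m≡n l≥l′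
... | inj₂ refl = inj₂ (one , l′ ∷ ls , ((l′>0 ∷ pos , dec) , ol′ ∷ odd) , refl)
... | inj₁ l>l′ with ol
...   | odd1 = contradiction l>l′ (≤⇒≯ l′>0)
...   | odd+2 ol-2 = inj₂ (two , _ ∷ l′ ∷ ls ,
                           ((odd⇒positive ol-2 ∷ l′>0 ∷ pos , odd-≤-pred ol′ ol-2 (≤-pred l>l′) ∷ dec) ,
                            ol-2 ∷ ol′ ∷ odd) ,
                           refl)

λo-decomposition : StepDecomposition λo IsOddPartition
λo-decomposition = record
  { step            = stepO
  ; f-[]            = refl
  ; f-[1]           = refl
  ; f-step          = λo-step
  ; P-[]            = ([] , []) , []
  ; P-[1]           = (s≤s z≤n ∷ [] , [-]) , odd1 ∷ []
  ; step-preserves  = stepO-preserves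
  ; step-perimeter  = stepO-perimeter
  ; step-injective  = stepO-injective
  ; step-surjective = stepO-surjective
  }

theorem11 : BijectionFromCOnto λd IsDistinctPartition
    × BijectionFromCOnto λo IsOddPartition
    × (∀ μ → InC μ → (perimeter (λd μ) ≡ size μ) × (perimeter (λo μ) ≡ size μ))
theorem11 = bijection λd-decomposition , bijection λo-decomposition ,
            λ μ c → perimeter-f λd-decomposition μ c , perimeter-f λo-decomposition μ c
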